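{- Let $\mathcal{C}$ be the graded set of integer compositions (finite sequences of positive integers, including the empty one), where the arity of $\lambda=(\lambda_1,\dots,\lambda_p)$ is $s_{1,p}(\lambda)$, with $s_{i,j}(\lambda):=1+\sum_{i\le k\le j}\lambda_k$. For $\lambda=(\lambda_1,\dots,\lambda_p)$ of arity $n$, $\mu=(\mu_1,\dots,\mu_q)$ of arity $m$ and $i\in[n]$, define $$\lambda\circ_i^{(1,2)}\mu:=\begin{cases}(\lambda_1,\dots,\lambda_p,\mu_1,\dots,\mu_q)&\text{if } i=n,\\ (\lambda_1,\dots,\lambda_k,\lambda_{k+1}+m-1,\lambda_{k+2},\dots,\lambda_p)&\text{otherwise},\end{cases}$$ where $k\ge0$ is such that $s_{1,k}(\lambda)\le i<s_{1,k+1}(\lambda)$. Then $(\mathcal{C},\circ_i^{(1,2)})$ is an operad (with unit the empty composition) isomorphic to $\mathbf{Mag}^{\{1,2\}}$.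
   Context: A binary tree is either the leaf or an ordered pair of binary trees. $\mathbf{Mag}$ is the nonsymmetric set-theoretic operad of binary trees ($\mathbf{Mag}(n)$ = trees with $n$ leaves), with $\mathfrak{t}\circ_i\mathfrak{s}$ grafting the root of $\mathfrak{s}$ onto the $i$-th leaf of $\mathfrak{t}$. Let $\mathfrak{a}_1=(((x_1x_2)x_3)x_4)$ and $\mathfrak{a}_2=((x_1(x_2x_3))x_4)$ denote the binary trees with $4$ leaves that are the syntax trees of these products. $\mathbf{Mag}^{\{1,2\}}=\mathbf{Mag}/_\equiv$, where $\equiv$ is the smallest operad congruence (arity-preserving equivalence relation compatible with all partial compositions) with $\mathfrak{a}_1\equiv\mathfrak{a}_2$. -}

module Defs where

open import Data.Nat using (ℕ; zero; suc; _+_; _∸_; _≤_; _<_; _≟_; _<?_; _≤?_)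
open import Data.List using (List; []; _∷_; _++_)
open import Data.Nat.ListAction using (sum)
open import Data.List.Relation.Unary.All using (All)
open import Data.Product using (Σ; _×_; _,_)
open import Relation.Nullary using (yes; no)
open import Relation.Binary.PropositionalEquality using (_≡_)
open import Function.Bundles using (_⇔_)

-- Binary trees and the magmatic operad Mag (indices are 1-based)

data Tree : Set where
  leaf : Tree
  node : Tree → Tree → Tree

leaves : Tree → ℕ
leaves leaf       = 1
leaves (node l r) = leaves l + leaves r

-- t ∘ᵢ s : graft the root of s onto the i-th leaf of t (i ∈ [leaves t];
-- out-of-range i leaves t unchanged, but is never used below).
graft : Tree → ℕ → Tree → Tree
graft leaf (suc zero) s = s
graft leaf _          s = leaf
graft (node l r) i s with i ≤? leaves l
... | yes _ = node (graft l i s) r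
... | no  _ = node l (graft r (i ∸ leaves l) s)

𝔞₁ : Tree
𝔞₁ = node (node (node leaf leaf) leaf) leaf

𝔞₂ : Tree
𝔞₂ = node (node leaf (node leaf leaf)) leaf

data _≡₁₂_ : Tree → Tree → Set where
  gen    : 𝔞₁ ≡₁₂ 𝔞₂
  refl₁₂ : ∀ {t} → t ≡₁₂ t
  sym₁₂  : ∀ {t s} → t ≡₁₂ s → s ≡₁₂ t
  trans₁₂ : ∀ {t s u} → t ≡₁₂ s → s ≡₁₂ u → t ≡₁₂ u
  comp₁₂ : ∀ {t t′ s s′ i} → 1 ≤ i → i ≤ leaves t →
           t ≡₁₂ t′ → s ≡₁₂ s′ → graft t i s ≡₁₂ graft t′ i s′

IsComp : List ℕ → Set
IsComp λ′ = All (1 ≤_) λ′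

arC : List ℕ → ℕ
arC λ′ = 1 + sum λ′

-- ins λ j a : with j = i - 1, find the k with s_{1,k} ≤ i < s_{1,k+1}
-- and add a to λ_{k+1}.
ins : List ℕ → ℕ → ℕ → List ℕ
ins []       j a = []
ins (x ∷ xs) j a with j <? x
... | yes _ = (x + a) ∷ xs
... | no  _ = x ∷ ins xs (j ∸ x) a

-- λ ∘ᵢ^{(1,2)} μ ; note m - 1 = sum μ where m = arC μ.
compC : List ℕ → ℕ → List ℕ → List ℕ
compC λ′ i μ with i ≟ arC λ′
... | yes _ = λ′ ++ μ
... | no  _ = ins λ′ (i ∸ 1) (sum μ)

unitC : List ℕ
unitC = []

record IsOperadC : Set where
  field
    unit-comp  : IsComp unitC × arC unitC ≡ 1
    comp-comp  : ∀ x y i → IsComp x → IsComp y → 1 ≤ i → i ≤ arC x →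
                 IsComp (compC x i y)
    comp-arity : ∀ x y i → IsComp x → IsComp y → 1 ≤ i → i ≤ arC x →
                 arC (compC x i y) ≡ arC x + arC y ∸ 1
    unit-left  : ∀ x → IsComp x → compC unitC 1 x ≡ x
    unit-right : ∀ x i → IsComp x → 1 ≤ i → i ≤ arC x → compC x i unitC ≡ x
    assoc-seq  : ∀ x y z i j → IsComp x → IsComp y → IsComp z →
                 1 ≤ i → i ≤ arC x → 1 ≤ j → j ≤ arC y →
                 compC (compC x i y) (i + j ∸ 1) z ≡ compC x i (compC y j z)
    assoc-par  : ∀ x y z i j → IsComp x → IsComp y → IsComp z →
                 1 ≤ i → i < j → j ≤ arC x →
                 compC (compC x i y) (j + arC y ∸ 1) z ≡ compC (compC x j z) i y

-- An operad isomorphism Mag/≡₁₂ → C, given by a map on representatives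
-- that is compatible with the congruence and injective on classes.

record IsIsoMag12C (φ : Tree → List ℕ) : Set where
  field
    φ-comp   : ∀ t → IsComp (φ t)
    φ-arity  : ∀ t → arC (φ t) ≡ leaves t
    φ-unit   : φ leaf ≡ unitC
    φ-graft  : ∀ t s i → 1 ≤ i → i ≤ leaves t →
               φ (graft t i s) ≡ compC (φ t) i (φ s)
    φ-kernel : ∀ t s → (φ t ≡ φ s) ⇔ (t ≡₁₂ s)
    φ-surj   : ∀ λ′ → IsComp λ′ → Σ Tree (λ t → φ t ≡ λ′)

-- A tree is determined up to ≡₁₂ by the leaf counts of the left subtrees hanging off
-- its right branch: the relation 𝔞₁ ≡₁₂ 𝔞₂, grafted into all contexts, reassociates
-- left subtrees freely, so every tree is congruent to a right comb of left combs.
-- This list of leaf counts is a composition, and grafting on the last leaf appends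
-- to it while grafting on any other leaf enlarges the left subtree containing that
-- leaf; this is exactly the composition ∘ᵢ^{(1,2)}. Hence the map is an operad
-- isomorphism Mag/≡₁₂ ≅ C, and the operad axioms of C are transported from those
-- of Mag along this surjection.
module Submission where

open import Defs
open import Data.List using (List; []; _∷_)
open import Data.List.Relation.Unary.All using ([]; _∷_)
open import Data.Nat using (ℕ; zero; suc; _+_; _∸_; _≤_; _<_; z≤n; s≤s; s≤s⁻¹; _≟_; _<?_; _≤?_)
open import Data.Nat.ListAction using (sum)
open import Data.Nat.Properties
open import Algebra.Properties.CommutativeSemigroup +-commutativeSemigroup using (xy∙z≈xz∙y)
open import Data.Product using (Σ; _×_; _,_)
open import Data.Sum using (inj₁; inj₂)
open import Function.Bundles using (mk⇔)
open import Relation.Nullary using (yes; no; contradiction)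
open import Relation.Binary.PropositionalEquality
open ≡-Reasoning

m≤m+n∸1 : ∀ m {n} → 1 ≤ n → m ≤ m + n ∸ 1
m≤m+n∸1 m {suc n} _ rewrite +-suc m n = m≤m+n m n

[m+n∸1]∸o≡m∸o+n∸1 : ∀ m n {o} → o ≤ m → (m + n ∸ 1) ∸ o ≡ m ∸ o + n ∸ 1
[m+n∸1]∸o≡m∸o+n∸1 m n {o} o≤m = begin
  (m + n ∸ 1) ∸ o  ≡⟨ ∸-+-assoc (m + n) 1 o ⟩
  m + n ∸ (1 + o)  ≡⟨ cong (m + n ∸_) (+-comm 1 o) ⟩
  m + n ∸ (o + 1)  ≡⟨ ∸-+-assoc (m + n) o 1 ⟨
  (m + n ∸ o) ∸ 1  ≡⟨ cong (_∸ 1) (+-∸-comm n o≤m) ⟩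
  m ∸ o + n ∸ 1    ∎

[m+o]∸[n+o]≡m∸n : ∀ m n o → m + o ∸ (n + o) ≡ m ∸ n
[m+o]∸[n+o]≡m∸n m n o = trans (cong₂ _∸_ (+-comm m o) (+-comm n o)) ([m+n]∸[m+o]≡n∸o o m n)

1≤leaves : ∀ t → 1 ≤ leaves t
1≤leaves leaf       = s≤s z≤n
1≤leaves (node l r) = ≤-trans (1≤leaves l) (m≤m+n _ _)

graft-nodeˡ : ∀ {l r i} s → i ≤ leaves l → graft (node l r) i s ≡ node (graft l i s) r
graft-nodeˡ {l} {i = i} s i≤l with i ≤? leaves l
... | yes _  = refl
... | no i≰l = contradiction i≤l i≰l

graft-nodeʳ : ∀ {l r i} s → leaves l < i →
              graft (node l r) i s ≡ node l (graft r (i ∸ leaves l) s)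
graft-nodeʳ {l} {i = i} s l<i with i ≤? leaves l
... | yes i≤l = contradiction i≤l (<⇒≱ l<i)
... | no _    = refl

leaves-graft : ∀ t s i → 1 ≤ i → i ≤ leaves t →
               suc (leaves (graft t i s)) ≡ leaves t + leaves s
leaves-graft leaf s 1 _ _ = refl
leaves-graft leaf s (suc (suc i)) _ (s≤s ())
leaves-graft (node l r) s i 1≤i i≤t with ≤-<-connex i (leaves l)
... | inj₁ i≤l = begin
  suc (leaves (graft (node l r) i s))   ≡⟨ cong (λ t → suc (leaves t)) (graft-nodeˡ s i≤l) ⟩
  suc (leaves (graft l i s)) + leaves r ≡⟨ cong (_+ leaves r) (leaves-graft l s i 1≤i i≤l) ⟩
  leaves l + leaves s + leaves r        ≡⟨ xy∙z≈xz∙y (leaves l) (leaves s) (leaves r) ⟩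
  leaves l + leaves r + leaves s        ∎
... | inj₂ l<i = begin
  suc (leaves (graft (node l r) i s))
    ≡⟨ cong (λ t → suc (leaves t)) (graft-nodeʳ s l<i) ⟩
  suc (leaves l + leaves (graft r (i ∸ leaves l) s))
    ≡⟨ +-suc (leaves l) _ ⟨
  leaves l + suc (leaves (graft r (i ∸ leaves l) s))
    ≡⟨ cong (leaves l +_) (leaves-graft r s (i ∸ leaves l) (m<n⇒0<n∸m l<i) (m≤n+o⇒m∸n≤o i (leaves l) i≤t)) ⟩
  leaves l + (leaves r + leaves s)
    ≡⟨ +-assoc (leaves l) (leaves r) (leaves s) ⟨
  leaves l + leaves r + leaves s ∎

module _ (t s : Tree) {i : ℕ} (1≤i : 1 ≤ i) (i≤t : i ≤ leaves t) where

  leaves≤leaves-graft : leaves t ≤ leaves (graft t i s)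
  leaves≤leaves-graft = s≤s⁻¹ (subst (suc (leaves t) ≤_) (sym (leaves-graft t s i 1≤i i≤t))
                                     (m<m+n (leaves t) (1≤leaves s)))

  +∸1≤leaves-graft : ∀ {a b} → a ≤ leaves t → b ≤ leaves s → a + b ∸ 1 ≤ leaves (graft t i s)
  +∸1≤leaves-graft {a} {b} a≤t b≤s =
    ∸-monoˡ-≤ 1 (subst (a + b ≤_) (sym (leaves-graft t s i 1≤i i≤t)) (+-mono-≤ a≤t b≤s))

  leaves-graft<+∸1 : ∀ {a} → leaves t < a → leaves (graft t i s) < a + leaves s ∸ 1
  leaves-graft<+∸1 {a} t<a =
    subst (_≤ a + leaves s ∸ 1) (sym (leaves-graft t s i 1≤i i≤t)) (∸-monoˡ-≤ 1 (+-monoˡ-≤ (leaves s) t<a))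

  +∸1∸leaves-graft : ∀ a → (a + leaves s ∸ 1) ∸ leaves (graft t i s) ≡ a ∸ leaves t
  +∸1∸leaves-graft a = begin
    (a + leaves s ∸ 1) ∸ leaves (graft t i s)  ≡⟨ ∸-+-assoc (a + leaves s) 1 _ ⟩
    a + leaves s ∸ suc (leaves (graft t i s))  ≡⟨ cong (a + leaves s ∸_) (leaves-graft t s i 1≤i i≤t) ⟩
    a + leaves s ∸ (leaves t + leaves s)       ≡⟨ [m+o]∸[n+o]≡m∸n a (leaves t) (leaves s) ⟩
    a ∸ leaves t                               ∎

graft-identityʳ : ∀ t i → graft t i leaf ≡ t
graft-identityʳ leaf zero          = refl
graft-identityʳ leaf (suc zero)    = refl
graft-identityʳ leaf (suc (suc i)) = refl
graft-identityʳ (node l r) i with i ≤? leaves l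
... | yes _ = cong (λ l′ → node l′ r) (graft-identityʳ l i)
... | no _  = cong (node l) (graft-identityʳ r (i ∸ leaves l))

graft-assoc : ∀ t s u i j → 1 ≤ i → i ≤ leaves t → 1 ≤ j → j ≤ leaves s →
              graft (graft t i s) (i + j ∸ 1) u ≡ graft t i (graft s j u)
graft-assoc leaf s u 1 j _ _ _ _ = refl
graft-assoc leaf s u (suc (suc i)) j _ (s≤s ()) _ _
graft-assoc (node l r) s u i j 1≤i i≤t 1≤j j≤s with ≤-<-connex i (leaves l)
... | inj₁ i≤l = begin
  graft (graft (node l r) i s) (i + j ∸ 1) u
    ≡⟨ cong (λ t → graft t (i + j ∸ 1) u) (graft-nodeˡ s i≤l) ⟩
  graft (node (graft l i s) r) (i + j ∸ 1) u
    ≡⟨ graft-nodeˡ u (+∸1≤leaves-graft l s 1≤i i≤l i≤l j≤s) ⟩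
  node (graft (graft l i s) (i + j ∸ 1) u) r
    ≡⟨ cong (λ l′ → node l′ r) (graft-assoc l s u i j 1≤i i≤l 1≤j j≤s) ⟩
  node (graft l i (graft s j u)) r
    ≡⟨ graft-nodeˡ (graft s j u) i≤l ⟨
  graft (node l r) i (graft s j u) ∎
... | inj₂ l<i = begin
  graft (graft (node l r) i s) (i + j ∸ 1) u
    ≡⟨ cong (λ t → graft t (i + j ∸ 1) u) (graft-nodeʳ s l<i) ⟩
  graft (node l (graft r i′ s)) (i + j ∸ 1) u
    ≡⟨ graft-nodeʳ u (<-≤-trans l<i (m≤m+n∸1 i 1≤j)) ⟩
  node l (graft (graft r i′ s) ((i + j ∸ 1) ∸ leaves l) u)
    ≡⟨ cong (λ k → node l (graft (graft r i′ s) k u)) ([m+n∸1]∸o≡m∸o+n∸1 i j (<⇒≤ l<i)) ⟩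
  node l (graft (graft r i′ s) (i′ + j ∸ 1) u)
    ≡⟨ cong (node l) (graft-assoc r s u i′ j (m<n⇒0<n∸m l<i) (m≤n+o⇒m∸n≤o i (leaves l) i≤t) 1≤j j≤s) ⟩
  node l (graft r i′ (graft s j u))
    ≡⟨ graft-nodeʳ (graft s j u) l<i ⟨
  graft (node l r) i (graft s j u) ∎
  where i′ = i ∸ leaves l

graft-comm-across : ∀ l r s u {i j} → 1 ≤ i → i ≤ leaves l → leaves l < j →
                    graft (graft (node l r) i s) (j + leaves s ∸ 1) u ≡ graft (graft (node l r) j u) i s
graft-comm-across l r s u {i} {j} 1≤i i≤l l<j = begin
  graft (graft (node l r) i s) k u
    ≡⟨ cong (λ t → graft t k u) (graft-nodeˡ s i≤l) ⟩
  graft (node (graft l i s) r) k u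
    ≡⟨ graft-nodeʳ u (leaves-graft<+∸1 l s 1≤i i≤l l<j) ⟩
  node (graft l i s) (graft r (k ∸ leaves (graft l i s)) u)
    ≡⟨ cong (λ k′ → node (graft l i s) (graft r k′ u)) (+∸1∸leaves-graft l s 1≤i i≤l j) ⟩
  node (graft l i s) (graft r (j ∸ leaves l) u)
    ≡⟨ graft-nodeˡ s i≤l ⟨
  graft (node l (graft r (j ∸ leaves l) u)) i s
    ≡⟨ cong (λ t → graft t i s) (graft-nodeʳ u l<j) ⟨
  graft (graft (node l r) j u) i s ∎
  where k = j + leaves s ∸ 1

graft-comm : ∀ t s u i j → 1 ≤ i → i < j → j ≤ leaves t →
             graft (graft t i s) (j + leaves s ∸ 1) u ≡ graft (graft t j u) i s
graft-comm leaf s u (suc i) (suc zero) _ (s≤s ()) _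
graft-comm leaf s u 1 (suc (suc j)) _ _ (s≤s ())
graft-comm (node l r) s u i j 1≤i i<j j≤t with ≤-<-connex j (leaves l)
... | inj₁ j≤l = begin
  graft (graft (node l r) i s) k u  ≡⟨ cong (λ t → graft t k u) (graft-nodeˡ s i≤l) ⟩
  graft (node (graft l i s) r) k u  ≡⟨ graft-nodeˡ u (+∸1≤leaves-graft l s 1≤i i≤l j≤l ≤-refl) ⟩
  node (graft (graft l i s) k u) r  ≡⟨ cong (λ l′ → node l′ r) (graft-comm l s u i j 1≤i i<j j≤l) ⟩
  node (graft (graft l j u) i s) r  ≡⟨ graft-nodeˡ s (≤-trans i≤l (leaves≤leaves-graft l u 1≤j j≤l)) ⟨
  graft (node (graft l j u) r) i s  ≡⟨ cong (λ t → graft t i s) (graft-nodeˡ u j≤l) ⟨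
  graft (graft (node l r) j u) i s  ∎
  where
  k = j + leaves s ∸ 1
  i≤l = ≤-trans (<⇒≤ i<j) j≤l
  1≤j = ≤-trans 1≤i (<⇒≤ i<j)
... | inj₂ l<j with ≤-<-connex i (leaves l)
...   | inj₁ i≤l = graft-comm-across l r s u 1≤i i≤l l<j
...   | inj₂ l<i = begin
  graft (graft (node l r) i s) k u
    ≡⟨ cong (λ t → graft t k u) (graft-nodeʳ s l<i) ⟩
  graft (node l (graft r i′ s)) k u
    ≡⟨ graft-nodeʳ u (<-≤-trans l<j (m≤m+n∸1 j (1≤leaves s))) ⟩
  node l (graft (graft r i′ s) (k ∸ leaves l) u)
    ≡⟨ cong (λ k′ → node l (graft (graft r i′ s) k′ u)) ([m+n∸1]∸o≡m∸o+n∸1 j (leaves s) (<⇒≤ l<j)) ⟩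
  node l (graft (graft r i′ s) (j′ + leaves s ∸ 1) u)
    ≡⟨ cong (node l) (graft-comm r s u i′ j′ (m<n⇒0<n∸m l<i) (∸-monoˡ-< i<j (<⇒≤ l<i)) (m≤n+o⇒m∸n≤o j (leaves l) j≤t)) ⟩
  node l (graft (graft r j′ u) i′ s)
    ≡⟨ graft-nodeʳ s l<i ⟨
  graft (node l (graft r j′ u)) i s
    ≡⟨ cong (λ t → graft t i s) (graft-nodeʳ u l<j) ⟨
  graft (graft (node l r) j u) i s ∎
  where
  k  = j + leaves s ∸ 1
  i′ = i ∸ leaves l
  j′ = j ∸ leaves l

toComp : Tree → List ℕ
toComp leaf       = []
toComp (node l r) = leaves l ∷ toComp r

toComp-isComp : ∀ t → IsComp (toComp t)
toComp-isComp leaf       = []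
toComp-isComp (node l r) = 1≤leaves l ∷ toComp-isComp r

toComp-arity : ∀ t → arC (toComp t) ≡ leaves t
toComp-arity leaf       = refl
toComp-arity (node l r) = trans (sym (+-suc (leaves l) _)) (cong (leaves l +_) (toComp-arity r))

compC-∷ˡ : ∀ {x xs i} ys → 1 ≤ i → i ≤ x → compC (x ∷ xs) i ys ≡ (x + sum ys) ∷ xs
compC-∷ˡ {x} {xs} {suc i} ys _ i<x with suc i ≟ arC (x ∷ xs)
... | yes i≡ = contradiction (≤-trans (subst (_≤ x) i≡ i<x) (m≤m+n x (sum xs))) 1+n≰n
... | no _ with i <? x
...   | yes _ = refl
...   | no i≮x = contradiction i<x i≮x

arC-∷ : ∀ x xs → arC (x ∷ xs) ≡ x + arC xs
arC-∷ x xs = sym (+-suc x (sum xs))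

compC-∷ʳ : ∀ {x xs i} ys → x < i → compC (x ∷ xs) i ys ≡ x ∷ compC xs (i ∸ x) ys
-- The two arity tests agree, as suc i ≡ x + arC xs iff suc i ∸ x ≡ arC xs when x ≤ suc i.
compC-∷ʳ {x} {xs} {suc i} ys (s≤s x≤i) with suc i ≟ arC (x ∷ xs) | suc i ∸ x ≟ arC xs
... | yes _  | yes _  = refl
... | yes i≡ | no i≢  = contradiction (trans (cong (_∸ x) (trans i≡ (arC-∷ x xs))) (m+n∸m≡n x _)) i≢
... | no i≢  | yes i≡ =
  contradiction (trans (sym (m+[n∸m]≡n (m≤n⇒m≤1+n x≤i))) (trans (cong (x +_) i≡) (sym (arC-∷ x xs)))) i≢
... | no _   | no _ with i <? x
...   | yes i<x = contradiction x≤i (<⇒≱ i<x)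
...   | no _    = cong (λ k → x ∷ ins xs k (sum ys)) (begin
  i ∸ x            ≡⟨⟩
  suc i ∸ suc x    ≡⟨ cong (suc i ∸_) (+-comm 1 x) ⟩
  suc i ∸ (x + 1)  ≡⟨ ∸-+-assoc (suc i) x 1 ⟨
  suc i ∸ x ∸ 1    ∎)

toComp-graft : ∀ t s i → 1 ≤ i → i ≤ leaves t → toComp (graft t i s) ≡ compC (toComp t) i (toComp s)
toComp-graft leaf s 1 _ _ = refl
toComp-graft leaf s (suc (suc i)) _ (s≤s ())
toComp-graft (node l r) s i 1≤i i≤t with ≤-<-connex i (leaves l)
... | inj₁ i≤l = begin
  toComp (graft (node l r) i s)          ≡⟨ cong toComp (graft-nodeˡ s i≤l) ⟩
  leaves (graft l i s) ∷ toComp r        ≡⟨ cong (_∷ toComp r) leaves-graft-l ⟩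
  (leaves l + sum (toComp s)) ∷ toComp r ≡⟨ compC-∷ˡ (toComp s) 1≤i i≤l ⟨
  compC (toComp (node l r)) i (toComp s) ∎
  where
  leaves-graft-l : leaves (graft l i s) ≡ leaves l + sum (toComp s)
  leaves-graft-l = suc-injective (begin
    suc (leaves (graft l i s))       ≡⟨ leaves-graft l s i 1≤i i≤l ⟩
    leaves l + leaves s              ≡⟨ cong (leaves l +_) (toComp-arity s) ⟨
    leaves l + arC (toComp s)        ≡⟨ +-suc (leaves l) _ ⟩
    suc (leaves l + sum (toComp s))  ∎)
... | inj₂ l<i = begin
  toComp (graft (node l r) i s)
    ≡⟨ cong toComp (graft-nodeʳ s l<i) ⟩
  leaves l ∷ toComp (graft r (i ∸ leaves l) s)
    ≡⟨ cong (leaves l ∷_) (toComp-graft r s (i ∸ leaves l) (m<n⇒0<n∸m l<i) (m≤n+o⇒m∸n≤o i (leaves l) i≤t)) ⟩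
  leaves l ∷ compC (toComp r) (i ∸ leaves l) (toComp s)
    ≡⟨ compC-∷ʳ (toComp s) l<i ⟨
  compC (toComp (node l r)) i (toComp s) ∎

toComp-resp-≡₁₂ : ∀ {t s} → t ≡₁₂ s → toComp t ≡ toComp s
toComp-resp-≡₁₂ gen           = refl
toComp-resp-≡₁₂ refl₁₂        = refl
toComp-resp-≡₁₂ (sym₁₂ p)     = sym (toComp-resp-≡₁₂ p)
toComp-resp-≡₁₂ (trans₁₂ p q) = trans (toComp-resp-≡₁₂ p) (toComp-resp-≡₁₂ q)
toComp-resp-≡₁₂ (comp₁₂ {t} {t′} {s} {s′} {i} 1≤i i≤t p q) = begin
  toComp (graft t i s)              ≡⟨ toComp-graft t s i 1≤i i≤t ⟩
  compC (toComp t) i (toComp s)     ≡⟨ cong₂ (λ a b → compC a i b) (toComp-resp-≡₁₂ p) (toComp-resp-≡₁₂ q) ⟩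
  compC (toComp t′) i (toComp s′)   ≡⟨ toComp-graft t′ s′ i 1≤i i≤t′ ⟨
  toComp (graft t′ i s′)            ∎
  where
  i≤t′ : i ≤ leaves t′
  i≤t′ = subst (i ≤_) (begin
    leaves t            ≡⟨ toComp-arity t ⟨
    arC (toComp t)      ≡⟨ cong arC (toComp-resp-≡₁₂ p) ⟩
    arC (toComp t′)     ≡⟨ toComp-arity t′ ⟩
    leaves t′           ∎) i≤t

leftComb : ℕ → Tree
leftComb zero    = leaf
leftComb (suc n) = node (leftComb n) leaf

leaves-leftComb : ∀ n → leaves (leftComb n) ≡ suc n
leaves-leftComb zero    = refl
leaves-leftComb (suc n) = trans (+-comm (leaves (leftComb n)) 1) (cong suc (leaves-leftComb n))

-- On compositions the truncated x ∸ 1 is exact, so leftComb (x ∸ 1) has x leaves.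
fromComp : List ℕ → Tree
fromComp []       = leaf
fromComp (x ∷ xs) = node (leftComb (x ∸ 1)) (fromComp xs)

toComp-fromComp : ∀ xs → IsComp xs → toComp (fromComp xs) ≡ xs
toComp-fromComp []            []               = refl
toComp-fromComp (suc x ∷ xs) (s≤s z≤n ∷ pxs) = cong₂ _∷_ (leaves-leftComb x) (toComp-fromComp xs pxs)

-- node a b is x₁ x₂ with b grafted at 2 and then a at 1.
node-cong₁₂ : ∀ {a a′ b b′} → a ≡₁₂ a′ → b ≡₁₂ b′ → node a b ≡₁₂ node a′ b′
node-cong₁₂ {b = b} {b′} a≡ b≡ =
  comp₁₂ {node leaf b} {node leaf b′} {i = 1} (s≤s z≤n) (s≤s z≤n)
    (comp₁₂ {node leaf leaf} {node leaf leaf} {i = 2} (s≤s z≤n) ≤-refl refl₁₂ b≡) a≡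

-- Graft w, z, y, x (from the last leaf, so indices do not shift) into 𝔞₁ ≡₁₂ 𝔞₂.
assoc₁₂ : ∀ x y z w → node (node (node x y) z) w ≡₁₂ node (node x (node y z)) w
assoc₁₂ x y z w =
  comp₁₂ {i = 1} (s≤s z≤n) (s≤s z≤n)
   (comp₁₂ {i = 2} (s≤s z≤n) (s≤s (s≤s z≤n))
    (comp₁₂ {i = 3} (s≤s z≤n) (s≤s (s≤s (s≤s z≤n)))
     (comp₁₂ {i = 4} (s≤s z≤n) ≤-refl gen (refl₁₂ {w})) (refl₁₂ {z})) (refl₁₂ {y})) (refl₁₂ {x})

leftComb-absorb₁₂ : ∀ n a b → node (node (leftComb n) a) b ≡₁₂ node (leftComb (n + leaves a)) b
leftComb-absorb₁₂ n leaf b = subst (λ k → node (node (leftComb n) leaf) b ≡₁₂ node (leftComb k) b) (+-comm 1 n) refl₁₂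
leftComb-absorb₁₂ n (node c d) b =
  trans₁₂ (sym₁₂ (assoc₁₂ (leftComb n) c d b))
  (trans₁₂ (node-cong₁₂ (leftComb-absorb₁₂ n c d) refl₁₂)
  (subst (λ k → node (node (leftComb (n + leaves c)) d) b ≡₁₂ node (leftComb k) b)
         (+-assoc n (leaves c) (leaves d))
         (leftComb-absorb₁₂ (n + leaves c) d b)))

node-leftComb₁₂ : ∀ a b → node a b ≡₁₂ node (leftComb (leaves a ∸ 1)) b
node-leftComb₁₂ leaf         b = refl₁₂
node-leftComb₁₂ (node a₁ a₂) b =
  trans₁₂ (node-cong₁₂ (node-leftComb₁₂ a₁ a₂) refl₁₂)
  (subst (λ k → node (node (leftComb (leaves a₁ ∸ 1)) a₂) b ≡₁₂ node (leftComb k) b)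
         (sym (+-∸-comm (leaves a₂) (1≤leaves a₁)))
         (leftComb-absorb₁₂ (leaves a₁ ∸ 1) a₂ b))

≡₁₂-fromComp-toComp : ∀ t → t ≡₁₂ fromComp (toComp t)
≡₁₂-fromComp-toComp leaf       = refl₁₂
≡₁₂-fromComp-toComp (node l r) = trans₁₂ (node-leftComb₁₂ l r) (node-cong₁₂ refl₁₂ (≡₁₂-fromComp-toComp r))

toComp≡⇒≡₁₂ : ∀ t s → toComp t ≡ toComp s → t ≡₁₂ s
toComp≡⇒≡₁₂ t s t≡s =
  trans₁₂ (≡₁₂-fromComp-toComp t)
          (subst (λ x → fromComp x ≡₁₂ s) (sym t≡s) (sym₁₂ (≡₁₂-fromComp-toComp s)))

-- Matching on image-of x cx replaces a composition x by toComp t for a tree t.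
data Image : List ℕ → Set where
  image : ∀ t → Image (toComp t)

image-of : ∀ x → IsComp x → Image x
image-of x cx = subst Image (toComp-fromComp x cx) (image (fromComp x))

≤arC⇒≤leaves : ∀ {i} t → i ≤ arC (toComp t) → i ≤ leaves t
≤arC⇒≤leaves {i} t = subst (i ≤_) (toComp-arity t)

compC-isComp : ∀ x y i → IsComp x → IsComp y → 1 ≤ i → i ≤ arC x → IsComp (compC x i y)
compC-isComp x y i cx cy 1≤i i≤x with image-of x cx | image-of y cy
... | image t | image s = subst IsComp (toComp-graft t s i 1≤i (≤arC⇒≤leaves t i≤x)) (toComp-isComp (graft t i s))

compC-arity : ∀ x y i → IsComp x → IsComp y → 1 ≤ i → i ≤ arC x → arC (compC x i y) ≡ arC x + arC y ∸ 1
compC-arity x y i cx cy 1≤i i≤x with image-of x cx | image-of y cy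
... | image t | image s = begin
  arC (compC (toComp t) i (toComp s))      ≡⟨ cong arC (toComp-graft t s i 1≤i i≤t) ⟨
  arC (toComp (graft t i s))               ≡⟨ toComp-arity (graft t i s) ⟩
  leaves (graft t i s)                     ≡⟨ cong (_∸ 1) (leaves-graft t s i 1≤i i≤t) ⟩
  leaves t + leaves s ∸ 1                  ≡⟨ cong₂ (λ a b → a + b ∸ 1) (toComp-arity t) (toComp-arity s) ⟨
  arC (toComp t) + arC (toComp s) ∸ 1      ∎
  where i≤t = ≤arC⇒≤leaves t i≤x

compC-identityʳ : ∀ x i → IsComp x → 1 ≤ i → i ≤ arC x → compC x i unitC ≡ x
compC-identityʳ x i cx 1≤i i≤x with image-of x cx
... | image t = begin
  compC (toComp t) i (toComp leaf)  ≡⟨ toComp-graft t leaf i 1≤i (≤arC⇒≤leaves t i≤x) ⟨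
  toComp (graft t i leaf)           ≡⟨ cong toComp (graft-identityʳ t i) ⟩
  toComp t                          ∎

compC-assoc : ∀ x y z i j → IsComp x → IsComp y → IsComp z →
              1 ≤ i → i ≤ arC x → 1 ≤ j → j ≤ arC y →
              compC (compC x i y) (i + j ∸ 1) z ≡ compC x i (compC y j z)
compC-assoc x y z i j cx cy cz 1≤i i≤x 1≤j j≤y with image-of x cx | image-of y cy | image-of z cz
... | image t | image s | image u = begin
  compC (compC (toComp t) i (toComp s)) k (toComp u)
    ≡⟨ cong (λ a → compC a k (toComp u)) (toComp-graft t s i 1≤i i≤t) ⟨
  compC (toComp (graft t i s)) k (toComp u)
    ≡⟨ toComp-graft (graft t i s) u k 1≤k k≤ts ⟨
  toComp (graft (graft t i s) k u)
    ≡⟨ cong toComp (graft-assoc t s u i j 1≤i i≤t 1≤j j≤s) ⟩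
  toComp (graft t i (graft s j u))
    ≡⟨ toComp-graft t (graft s j u) i 1≤i i≤t ⟩
  compC (toComp t) i (toComp (graft s j u))
    ≡⟨ cong (compC (toComp t) i) (toComp-graft s u j 1≤j j≤s) ⟩
  compC (toComp t) i (compC (toComp s) j (toComp u)) ∎
  where
  k    = i + j ∸ 1
  i≤t  = ≤arC⇒≤leaves t i≤x
  j≤s  = ≤arC⇒≤leaves s j≤y
  1≤k  = ≤-trans 1≤i (m≤m+n∸1 i 1≤j)
  k≤ts = +∸1≤leaves-graft t s 1≤i i≤t i≤t j≤s

compC-comm : ∀ x y z i j → IsComp x → IsComp y → IsComp z →
             1 ≤ i → i < j → j ≤ arC x →
             compC (compC x i y) (j + arC y ∸ 1) z ≡ compC (compC x j z) i y
compC-comm x y z i j cx cy cz 1≤i i<j j≤x with image-of x cx | image-of y cy | image-of z cz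
... | image t | image s | image u = begin
  compC (compC (toComp t) i (toComp s)) (j + arC (toComp s) ∸ 1) (toComp u)
    ≡⟨ cong₂ (λ a n → compC a (j + n ∸ 1) (toComp u)) (toComp-graft t s i 1≤i i≤t) (sym (toComp-arity s)) ⟨
  compC (toComp (graft t i s)) k (toComp u)  ≡⟨ toComp-graft (graft t i s) u k 1≤k k≤ts ⟨
  toComp (graft (graft t i s) k u)           ≡⟨ cong toComp (graft-comm t s u i j 1≤i i<j j≤t) ⟩
  toComp (graft (graft t j u) i s)           ≡⟨ toComp-graft (graft t j u) s i 1≤i i≤tu ⟩
  compC (toComp (graft t j u)) i (toComp s)  ≡⟨ cong (λ a → compC a i (toComp s)) (toComp-graft t u j 1≤j j≤t) ⟩
  compC (compC (toComp t) j (toComp u)) i (toComp s) ∎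
  where
  k    = j + leaves s ∸ 1
  j≤t  = ≤arC⇒≤leaves t j≤x
  i≤t  = ≤-trans (<⇒≤ i<j) j≤t
  1≤j  = ≤-trans 1≤i (<⇒≤ i<j)
  1≤k  = ≤-trans 1≤j (m≤m+n∸1 j (1≤leaves s))
  k≤ts = +∸1≤leaves-graft t s 1≤i i≤t j≤t ≤-refl
  i≤tu = ≤-trans i≤t (leaves≤leaves-graft t u 1≤j j≤t)

operadC : IsOperadC
operadC = record
  { unit-comp  = [] , refl
  ; comp-comp  = compC-isComp
  ; comp-arity = compC-arity
  ; unit-left  = λ _ _ → refl
  ; unit-right = compC-identityʳ
  ; assoc-seq  = compC-assoc
  ; assoc-par  = compC-comm
  }

toComp-isIso : IsIsoMag12C toComp
toComp-isIso = record
  { φ-comp   = toComp-isComp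
  ; φ-arity  = toComp-arity
  ; φ-unit   = refl
  ; φ-graft  = toComp-graft
  ; φ-kernel = λ t s → mk⇔ (toComp≡⇒≡₁₂ t s) toComp-resp-≡₁₂
  ; φ-surj   = λ x cx → fromComp x , toComp-fromComp x cx
  }

proposition4p2p3 : IsOperadC × Σ (Tree → List ℕ) IsIsoMag12C
proposition4p2p3 = operadC , toComp , toComp-isIso
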